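{- Let $K=\{k_1,k_2,k_3,k_4\}$ be a multiset of four integers such that (1) $k_i\ge 3$ for $i=1,2,3,4$; (2) at most two of the elements of $K$ equal $3$; (3) $\sum_{i=1}^4 k_i\ge 18$. Then $\sum_{i=1}^4 \frac{k_i-3}{k_i}<1$ if and only if $K$ is one of the multisets $\{3,3,4,8\}$, $\{3,3,4,9\}$, $\{3,3,4,10\}$, $\{3,3,4,11\}$, $\{3,3,5,7\}$. -}

module Defs where

open import Data.Nat using (ℕ; zero; suc; _≟_; _∸_)
open import Data.Integer using (+_)
open import Data.List using (List; _∷_; []; length; filter)
open import Data.Rational using (ℚ; _/_; 0ℚ)

count3 : List ℕ → ℕ
count3 xs = length (filter (_≟ 3) xs)

-- (k - 3) / k as a rational number.  Only used for k ≥ 3, where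
-- k ∸ 3 is the true difference k - 3; the value at k = 0 is a junk value.
term : ℕ → ℚ
term zero = 0ℚ
term (suc m) = (+ (suc m ∸ 3)) / suc m

-- For k ≥ 3 the term (k − 3)/k = 1 − 3/k increases with k.  If some kᵢ ≥ 12 its
-- term is at least 3/4, and as at most two of the remaining three entries equal 3,
-- one of them is at least 4 and contributes at least 1/4: the sum is at least 1.
-- So a solution lies in the box 3 ≤ kᵢ ≤ 11, which is checked exhaustively,
-- deciding equality of multisets by comparing sorted lists.
module Submission where

open import Defs
open import Data.Nat using (ℕ; _≤_; _+_)
open import Data.List using (List; _∷_; [])
open import Data.Sum using (_⊎_)
open import Data.Rational using (1ℚ) renaming (_+_ to _+ℚ_; _<_ to _<ℚ_)
open import Function.Bundles using (_⇔_)
open import Data.List.Relation.Binary.Permutation.Propositional using (_↭_)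

open import Algebra.Bundles using (CommutativeMonoid)
open import Data.Integer using (+_; +≤+) renaming (_≤_ to _≤ℤ_)
import Data.Integer.Properties as ℤ
open import Data.List using (foldr; map; length)
open import Data.List.Membership.Propositional using (_∈_; find)
open import Data.List.Membership.Propositional.Properties using (∈-∃++)
open import Data.List.Properties using (≡-dec; filter-reject)
open import Data.List.Relation.Binary.Permutation.Propositional
  using (↭-sym; ↭-trans; ↭-reflexive; ↭⇒↭ₛ)
open import Data.List.Relation.Binary.Permutation.Propositional.Properties
  using (All-resp-↭; ↭-length; filter-↭; shift; map⁺)
open import Data.List.Relation.Binary.Permutation.Setoid.Properties using (foldr-commMonoid)
open import Data.List.Relation.Binary.Pointwise using (Pointwise-≡⇒≡)
open import Data.List.Relation.Unary.All using (All; []; _∷_; all?)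
open import Data.List.Relation.Unary.All.Properties using (¬All⇒Any¬)
open import Data.List.Relation.Unary.Any using (Any; here; there)
open import Data.List.Relation.Unary.Sorted.TotalOrder.Properties using (↗↭↗⇒≋)
open import Data.Nat using (suc; _*_; _<_; _≟_; _≤?_; s≤s)
import Data.Nat.Properties as ℕ
open import Data.Nat.Tactic.RingSolver using (solve-∀)
open import Data.List.Sort.InsertionSort ℕ.≤-decTotalOrder using (sort)
open import Data.List.Sort.InsertionSort.Properties ℕ.≤-decTotalOrder using (sort-↭; sort-↗)
open import Data.Product using (∃; _,_)
open import Data.Rational using (ℚ; 0ℚ; _/_; toℚᵘ)
  renaming (_≤_ to _≤ℚ_; _<?_ to _<ℚ?_)
import Data.Rational.Properties as ℚ
open import Data.Rational.Unnormalised using (mkℚᵘ; *≤*; _≃_)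
import Data.Rational.Unnormalised.Properties as ℚᵘ
open import Data.Sum using (inj₁; inj₂)
open import Function.Base using (_∘_)
open import Function.Bundles using (mk⇔)
open import Relation.Binary.PropositionalEquality
open import Relation.Nullary using (Dec; yes; no)
import Relation.Nullary.Decidable as Dec
open import Relation.Nullary.Decidable
  using (map′; from-yes; decidable-stable; True; toWitness; _⊎-dec_; _→-dec_)
open import Relation.Unary using (Pred; Decidable)

sort≡sort⇔↭ : {xs ys : List ℕ} → (sort xs ≡ sort ys) ⇔ (xs ↭ ys)
sort≡sort⇔↭ {xs} {ys} = mk⇔ sort≡sort⇒↭ ↭⇒sort≡sort
  where
  sort≡sort⇒↭ : sort xs ≡ sort ys → xs ↭ ys
  sort≡sort⇒↭ eq = ↭-trans (↭-sym (sort-↭ xs)) (↭-trans (↭-reflexive eq) (sort-↭ ys))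
  ↭⇒sort≡sort : xs ↭ ys → sort xs ≡ sort ys
  ↭⇒sort≡sort p = Pointwise-≡⇒≡ (↗↭↗⇒≋ ℕ.≤-totalOrder (sort-↗ xs) (sort-↗ ys)
    (↭⇒↭ₛ (↭-trans (sort-↭ xs) (↭-trans p (↭-sym (sort-↭ ys))))))

_↭?_ : (xs ys : List ℕ) → Dec (xs ↭ ys)
xs ↭? ys = Dec.map sort≡sort⇔↭ (≡-dec _≟_ (sort xs) (sort ys))

∀-between? : ∀ {p} {P : Pred ℕ p} → Decidable P →
             ∀ l u → Dec (∀ {k} → l ≤ k → k ≤ u → P k)
∀-between? P? l u = map′
  (λ h {k} l≤k k≤u → h {k} (s≤s k≤u) l≤k)
  (λ h {k} k<1+u l≤k → h {k} l≤k (ℕ.≤-pred k<1+u))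
  (ℕ.allUpTo? (λ k → l ≤? k →-dec P? k) (suc u))

term-mono-+ : ∀ i j → term (3 + i) ≤ℚ term (3 + i + j)
term-mono-+ i j = ℚ.toℚᵘ-cancel-≤
  (ℚᵘ.≤-respʳ-≃ (as-ℚᵘ (i + j) (2 + i + j)) (ℚᵘ.≤-respˡ-≃ (as-ℚᵘ i (2 + i))
    (*≤* (subst₂ _≤ℤ_ (ℤ.pos-* i (3 + i + j)) (ℤ.pos-* (i + j) (3 + i))
      (+≤+ cross-multiplied)))))
  where
  as-ℚᵘ : ∀ n d-1 → mkℚᵘ (+ n) d-1 ≃ toℚᵘ (+ n / suc d-1)
  as-ℚᵘ n d-1 = ℚᵘ.≃-sym (ℚ.toℚᵘ-fromℚᵘ (mkℚᵘ (+ n) d-1))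
  expand : ∀ i j → i * (3 + i + j) + 3 * j ≡ (i + j) * (3 + i)
  expand = solve-∀
  cross-multiplied : i * (3 + i + j) ≤ (i + j) * (3 + i)
  cross-multiplied = subst (i * (3 + i + j) ≤_) (expand i j) (ℕ.m≤m+n _ (3 * j))

term-mono : ∀ {m n} → 3 ≤ m → m ≤ n → term m ≤ℚ term n
term-mono 3≤m m≤n
  with i , refl ← ℕ.m≤n⇒∃[o]m+o≡n 3≤m | j , refl ← ℕ.m≤n⇒∃[o]m+o≡n m≤n = term-mono-+ i j

term-nonneg : ∀ {k} → 3 ≤ k → 0ℚ ≤ℚ term k
term-nonneg = term-mono ℕ.≤-refl

¼≤term : ∀ {k} → 4 ≤ k → + 1 / 4 ≤ℚ term k
¼≤term = term-mono (ℕ.n≤1+n 3)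

¾≤term : ∀ {k} → 12 ≤ k → + 3 / 4 ≤ℚ term k
¾≤term = term-mono (ℕ.m≤m+n 3 9)

termSum : List ℕ → ℚ
termSum ks = foldr _+ℚ_ 0ℚ (map term ks)

termSum-↭ : ∀ {ks ls} → ks ↭ ls → termSum ks ≡ termSum ls
termSum-↭ p = foldr-commMonoid ℚ+.setoid ℚ+.isCommutativeMonoid (↭⇒↭ₛ (map⁺ term p))
  where module ℚ+ = CommutativeMonoid ℚ.+-0-commutativeMonoid

termSum-4 : ∀ a b c d →
            term a +ℚ term b +ℚ term c +ℚ term d ≡ termSum (a ∷ b ∷ c ∷ d ∷ [])
termSum-4 a b c d = begin
  term a +ℚ term b +ℚ term c +ℚ term d      ≡⟨ ℚ.+-assoc (term a +ℚ term b) (term c) (term d) ⟩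
  term a +ℚ term b +ℚ (term c +ℚ term d)    ≡⟨ ℚ.+-assoc (term a) (term b) (term c +ℚ term d) ⟩
  term a +ℚ (term b +ℚ (term c +ℚ term d))  ≡⟨ cong (λ t → term a +ℚ (term b +ℚ (term c +ℚ t)))
                                                    (ℚ.+-identityʳ (term d)) ⟨
  termSum (a ∷ b ∷ c ∷ d ∷ [])              ∎
  where open ≡-Reasoning

termSum-nonneg : ∀ {ks} → All (3 ≤_) ks → 0ℚ ≤ℚ termSum ks
termSum-nonneg []           = ℚ.≤-refl
termSum-nonneg (3≤k ∷ 3≤ks) = ℚ.+-mono-≤ (term-nonneg 3≤k) (termSum-nonneg 3≤ks)

¼≤termSum : ∀ {ks} → All (3 ≤_) ks → Any (4 ≤_) ks → + 1 / 4 ≤ℚ termSum ks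
¼≤termSum (_   ∷ 3≤ks) (here 4≤k)  = ℚ.+-mono-≤ (¼≤term 4≤k) (termSum-nonneg 3≤ks)
¼≤termSum (3≤k ∷ 3≤ks) (there ∃4≤) = ℚ.+-mono-≤ (term-nonneg 3≤k) (¼≤termSum 3≤ks ∃4≤)

count3-↭ : ∀ {xs ys} → xs ↭ ys → count3 xs ≡ count3 ys
count3-↭ = ↭-length ∘ filter-↭ (_≟ 3)

count3-∷-≢ : ∀ {x} xs → x ≢ 3 → count3 (x ∷ xs) ≡ count3 xs
count3-∷-≢ xs x≢3 = cong length (filter-reject (_≟ 3) x≢3)

count3<length⇒Any≥4 : ∀ {ks} → All (3 ≤_) ks → count3 ks < length ks → Any (4 ≤_) ks
count3<length⇒Any≥4 {k ∷ ks} (3≤k ∷ 3≤ks) c<l with k ≟ 3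
... | yes refl = there (count3<length⇒Any≥4 3≤ks (ℕ.≤-pred c<l))
... | no  k≢3  = here (ℕ.≤∧≢⇒< 3≤k (k≢3 ∘ sym))

∈⇒↭∷ : ∀ {x : ℕ} {xs} → x ∈ xs → ∃ λ ys → xs ↭ x ∷ ys
∈⇒↭∷ x∈xs with ys , zs , refl ← ∈-∃++ x∈xs = _ , shift _ ys zs

1≤termSum : ∀ {ks x} → All (3 ≤_) ks → suc (count3 ks) < length ks →
            x ∈ ks → 12 ≤ x → 1ℚ ≤ℚ termSum ks
1≤termSum {ks} {x} 3≤ks two≢3 x∈ks 12≤x with rest , ks↭ ← ∈⇒↭∷ x∈ks = begin
  1ℚ                      ≡⟨⟩
  + 3 / 4 +ℚ + 1 / 4      ≤⟨ ℚ.+-mono-≤ (¾≤term 12≤x) (¼≤termSum 3≤rest (count3<length⇒Any≥4 3≤rest c<l)) ⟩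
  term x +ℚ termSum rest  ≡⟨ termSum-↭ (↭-sym ks↭) ⟩
  termSum ks              ∎
  where
  open ℚ.≤-Reasoning
  3≤rest : All (3 ≤_) rest
  3≤rest with _ ∷ 3≤rest ← All-resp-↭ ks↭ 3≤ks = 3≤rest
  x≢3 : x ≢ 3
  x≢3 = ℕ.>⇒≢ (ℕ.<-≤-trans (ℕ.m≤m+n 4 8) 12≤x)
  c<l : count3 rest < length rest
  c<l = ℕ.≤-pred (subst₂ (λ c l → suc c < l)
    (trans (count3-↭ ks↭) (count3-∷-≢ rest x≢3)) (↭-length ks↭) two≢3)

termSum<1⇒≤11 : ∀ {ks} → All (3 ≤_) ks → suc (count3 ks) < length ks →
                termSum ks <ℚ 1ℚ → All (_≤ 11) ks
termSum<1⇒≤11 {ks} 3≤ks two≢3 ks<1 = decidable-stable (all? (_≤? 11) ks) λ ks≰11 →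
  let x , x∈ks , x≰11 = find (¬All⇒Any¬ (_≤? 11) ks ks≰11)
  in ℚ.<-irrefl refl (ℚ.≤-<-trans (1≤termSum 3≤ks two≢3 x∈ks (ℕ.≰⇒> x≰11)) ks<1)

Exceptional : List ℕ → Set
Exceptional ks = ks ↭ (3 ∷ 3 ∷ 4 ∷ 8 ∷ [])
               ⊎ ks ↭ (3 ∷ 3 ∷ 4 ∷ 9 ∷ [])
               ⊎ ks ↭ (3 ∷ 3 ∷ 4 ∷ 10 ∷ [])
               ⊎ ks ↭ (3 ∷ 3 ∷ 4 ∷ 11 ∷ [])
               ⊎ ks ↭ (3 ∷ 3 ∷ 5 ∷ 7 ∷ [])

exceptional? : (ks : List ℕ) → Dec (Exceptional ks)
exceptional? ks = ks ↭? _ ⊎-dec ks ↭? _ ⊎-dec ks ↭? _ ⊎-dec ks ↭? _ ⊎-dec ks ↭? _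

termSum<1-resp-↭ : ∀ {ks ls} → ks ↭ ls → {True (termSum ls <ℚ? 1ℚ)} → termSum ks <ℚ 1ℚ
termSum<1-resp-↭ p {ls<1} = subst (_<ℚ 1ℚ) (termSum-↭ (↭-sym p)) (toWitness ls<1)

exceptional⇒termSum<1 : ∀ {ks} → Exceptional ks → termSum ks <ℚ 1ℚ
exceptional⇒termSum<1 (inj₁ p)                      = termSum<1-resp-↭ p
exceptional⇒termSum<1 (inj₂ (inj₁ p))               = termSum<1-resp-↭ p
exceptional⇒termSum<1 (inj₂ (inj₂ (inj₁ p)))        = termSum<1-resp-↭ p
exceptional⇒termSum<1 (inj₂ (inj₂ (inj₂ (inj₁ p)))) = termSum<1-resp-↭ p
exceptional⇒termSum<1 (inj₂ (inj₂ (inj₂ (inj₂ p)))) = termSum<1-resp-↭ p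

SmallCase : ℕ → ℕ → ℕ → ℕ → Set
SmallCase a b c d =
  count3 (a ∷ b ∷ c ∷ d ∷ []) ≤ 2 → 18 ≤ a + b + c + d →
  termSum (a ∷ b ∷ c ∷ d ∷ []) <ℚ 1ℚ → Exceptional (a ∷ b ∷ c ∷ d ∷ [])

smallCase? : ∀ a b c d → Dec (SmallCase a b c d)
smallCase? a b c d =
  count3 ks ≤? 2 →-dec 18 ≤? a + b + c + d →-dec termSum ks <ℚ? 1ℚ →-dec exceptional? ks
  where ks = a ∷ b ∷ c ∷ d ∷ []

allSmallCases : ∀ {a} → 3 ≤ a → a ≤ 11 → ∀ {b} → 3 ≤ b → b ≤ 11 →
                ∀ {c} → 3 ≤ c → c ≤ 11 → ∀ {d} → 3 ≤ d → d ≤ 11 → SmallCase a b c d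
allSmallCases = from-yes (∀-between? (λ a → ∀-between? (λ b → ∀-between? (λ c →
  ∀-between? (smallCase? a b c) 3 11) 3 11) 3 11) 3 11)

smallCase : ∀ {a b c d} → All (3 ≤_) (a ∷ b ∷ c ∷ d ∷ []) → All (_≤ 11) (a ∷ b ∷ c ∷ d ∷ []) →
            SmallCase a b c d
smallCase (3≤a ∷ 3≤b ∷ 3≤c ∷ 3≤d ∷ []) (a≤11 ∷ b≤11 ∷ c≤11 ∷ d≤11 ∷ []) =
  allSmallCases 3≤a a≤11 3≤b b≤11 3≤c c≤11 3≤d d≤11

lemma1 : (k₁ k₂ k₃ k₄ : ℕ)
    → 3 ≤ k₁ → 3 ≤ k₂ → 3 ≤ k₃ → 3 ≤ k₄
    → count3 (k₁ ∷ k₂ ∷ k₃ ∷ k₄ ∷ []) ≤ 2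
    → 18 ≤ k₁ + k₂ + k₃ + k₄
    → ((term k₁ +ℚ term k₂ +ℚ term k₃ +ℚ term k₄) <ℚ 1ℚ)
      ⇔ ((k₁ ∷ k₂ ∷ k₃ ∷ k₄ ∷ []) ↭ (3 ∷ 3 ∷ 4 ∷ 8 ∷ [])
        ⊎ (k₁ ∷ k₂ ∷ k₃ ∷ k₄ ∷ []) ↭ (3 ∷ 3 ∷ 4 ∷ 9 ∷ [])
        ⊎ (k₁ ∷ k₂ ∷ k₃ ∷ k₄ ∷ []) ↭ (3 ∷ 3 ∷ 4 ∷ 10 ∷ [])
        ⊎ (k₁ ∷ k₂ ∷ k₃ ∷ k₄ ∷ []) ↭ (3 ∷ 3 ∷ 4 ∷ 11 ∷ [])
        ⊎ (k₁ ∷ k₂ ∷ k₃ ∷ k₄ ∷ []) ↭ (3 ∷ 3 ∷ 5 ∷ 7 ∷ []))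
lemma1 k₁ k₂ k₃ k₄ 3≤k₁ 3≤k₂ 3≤k₃ 3≤k₄ count3≤2 18≤Σ = mk⇔
  (termSum<1⇒exceptional ∘ subst (_<ℚ 1ℚ) (termSum-4 k₁ k₂ k₃ k₄))
  (subst (_<ℚ 1ℚ) (sym (termSum-4 k₁ k₂ k₃ k₄)) ∘ exceptional⇒termSum<1)
  where
  3≤ks : All (3 ≤_) (k₁ ∷ k₂ ∷ k₃ ∷ k₄ ∷ [])
  3≤ks = 3≤k₁ ∷ 3≤k₂ ∷ 3≤k₃ ∷ 3≤k₄ ∷ []
  termSum<1⇒exceptional : termSum (k₁ ∷ k₂ ∷ k₃ ∷ k₄ ∷ []) <ℚ 1ℚ →
                          Exceptional (k₁ ∷ k₂ ∷ k₃ ∷ k₄ ∷ [])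
  termSum<1⇒exceptional ks<1 =
    smallCase 3≤ks (termSum<1⇒≤11 3≤ks (s≤s (s≤s count3≤2)) ks<1) count3≤2 18≤Σ ks<1
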